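{- Let $p$ be a prime, $m$ a positive integer divisible by $3$, $n=\frac m3(p-1)$, $U=[0,n]^2$. Let $J$ and $K$ be ideals of $U$ with boundaries $W=\omega_U(J)$ and $Z=\omega_U(K)$. Let $a\ge0$, $b\ge0$ be integers and let $\bar K$ be the largest ideal of $[0,a+n]\times[-b,n]$ with $\bar K\cap U=K$. Then the following are equivalent: (i) $\bigl[J+D+(a,-b)\bigr]\cap U\subseteq K$; (ii) $J+(a,-b)\subseteq\bar K\cap\bigl((a,-b)+U\bigr)$; (iii) $\bigl[J+D+(a,-b)\bigr]\cap\bigl([0,a+n]\times[-b,n]\bigr)\subseteq\bar K$; (iv) $\bigl[\underline{(W+(a,-b))}_{[0,a+n]\times[-b,n]}\bigr]\big|_U\le Z$; (v) $W+(a,-b)\le\bigl[\overline{Z}_{[0,a+n]\times[-b,n]}\bigr]\big|_{[a,a+n]\times[-b,-b+n]}$; (vi) $\underline{(W+(a,-b))}_{[0,a+n]\times[-b,n]}\le\overline{Z}_{[0,a+n]\times[-b,n]}$.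
   Context: $D=\{(x,y)\in\mathbb{R}^2: x+py\le 0,\ p^2x+y\le 0\}$; $u\prec v$ means $u\in v+D$. An ideal of $\Omega\subseteq\mathbb{R}^2$ is $I\subseteq\Omega$ with $u\in I$, $v\in\Omega$, $v\prec u\Rightarrow v\in I$. $[a,b]=\{x\in\mathbb{Z}:a\le x\le b\}$; sums are Minkowski sums. Walks: a rectangle is $R=[a,b]\times[c,d]$ ($a\le b$, $c\le d$ integers). A walk in $R$ is the empty sequence $\emptyset$ or a sequence $(x_0,y_0),\dots,(x_k,y_k)$ of points of $R$ with: (1) $x_0=a$ or $y_0=d$, and $x_k=b$ or $y_k=c$; (2) each step is horizontal, $(x_t,y_t)=(x_{t-1}+h,y_{t-1})$ with $1\le h\le p$, or vertical, $(x_t,y_t)=(x_{t-1},y_{t-1}-v)$ with $1\le v\le p^2$; (3) steps alternate; (4) if $a\le x_0<b$ and $y_0=d$ the first step is vertical, and if $x_k=b$, $c\le y_k<d$ the last step is horizontal; (5) a horizontal first step has length $\le p-1$ and a vertical last step has length $\le p^2-1$. $\iota_R(W)=\{(x,y)\in R: x\le x_t,\ y\le y_t\text{ for some }t\}$, $\iota_R(\emptyset)=\emptyset$; $\iota_R$ is a bijection from walks in $R$ to ideals of $R$, with inverse $\omega_R$. $W_1\le W_2$ iff $\iota_R(W_1)\subseteq\iota_R(W_2)$. For rectangles $R'\subseteq R$: $W|_{R'}=\omega_{R'}(\iota_R(W)\cap R')$; for $Z$ a walk in $R'$, $\overline{Z}_R=\omega_R(K)$ with $K$ the largest ideal of $R$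 with $K\cap R'=\iota_{R'}(Z)$, and $\underline{Z}_R=\omega_R(L)$ with $L$ the smallest such ideal. $W+(h,v)$ is $W$ translated by $(h,v)$ (a walk in the translated rectangle). -}

module Defs where

open import Level using (0ℓ)
open import Data.Nat as ℕ using (ℕ)
open import Data.Integer using (ℤ; +_; _+_; _-_; -_; _*_; _≤_; _<_; 0ℤ; 1ℤ)
open import Data.Product using (_×_; _,_; proj₁; proj₂; ∃; ∃-syntax; Σ)
open import Data.Sum using (_⊎_)
open import Data.Unit using (⊤)
open import Data.List using (List; []; _∷_; _++_; map)
open import Data.List.Relation.Unary.All using (All)
open import Data.List.Relation.Unary.Any using (Any)
open import Relation.Binary.PropositionalEquality using (_≡_)
open import Relation.Unary using (Pred; _⊆_; _∩_; _≐_)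

Point : Set
Point = ℤ × ℤ

xc : Point → ℤ
xc = proj₁

yc : Point → ℤ
yc = proj₂

_⊕_ : Point → Point → Point
(x , y) ⊕ (x' , y') = (x + x' , y + y')

_⊖_ : Point → Point → Point
(x , y) ⊖ (x' , y') = (x - x' , y - y')

InD : ℕ → Point → Set
InD p (x , y) = (x + (+ p) * y ≤ 0ℤ) × ((+ p) * (+ p) * x + y ≤ 0ℤ)

Prec : ℕ → Point → Point → Set
Prec p u v = InD p (u ⊖ v)

record Rect : Set where
  constructor rect
  field
    xlo xhi ylo yhi : ℤ
open Rect public

InRect : Rect → Pred Point 0ℓ
InRect (rect a b c d) (x , y) = (a ≤ x × x ≤ b) × (c ≤ y × y ≤ d)

translateRect : Point → Rect → Rect
translateRect (h , v) (rect a b c d) = rect (a + h) (b + h) (c + v) (d + v)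

IsIdeal : ℕ → Pred Point 0ℓ → Pred Point 0ℓ → Set
IsIdeal p Ω I = (I ⊆ Ω) × (∀ u v → I u → Ω v → Prec p v u → I v)

-- Minkowski sums X + t and X + D + t (restricted to integer points)
ShiftSet : Pred Point 0ℓ → Point → Pred Point 0ℓ
ShiftSet X t u = X (u ⊖ t)

ShiftCone : ℕ → Pred Point 0ℓ → Point → Pred Point 0ℓ
ShiftCone p X t u = ∃[ j ] (X j × InD p ((u ⊖ j) ⊖ t))

data Kind : Set where
  H V : Kind

flipK : Kind → Kind
flipK H = V
flipK V = H

Step : ℕ → Kind → Point → Point → Set
Step p H u v = (yc v ≡ yc u) × (1ℤ ≤ xc v - xc u × xc v - xc u ≤ + p)
Step p V u v = (xc v ≡ xc u) × (1ℤ ≤ yc u - yc v × yc u - yc v ≤ + (p ℕ.* p))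

AltChain : ℕ → Kind → Point → List Point → Set
AltChain p k u [] = ⊤
AltChain p k u (v ∷ rest) = Step p k u v × AltChain p (flipK k) v rest

IsWalk : ℕ → Rect → List Point → Set
IsWalk p R@(rect a b c d) W =
    All (InRect R) W
  × (∀ u rest → W ≡ u ∷ rest → (xc u ≡ a ⊎ yc u ≡ d))
  × (∀ ws z → W ≡ ws ++ (z ∷ []) → (xc z ≡ b ⊎ yc z ≡ c))
  × (∀ u rest → W ≡ u ∷ rest → ∃[ k ] AltChain p k u rest)
  × (∀ u v rest → W ≡ u ∷ v ∷ rest → (a ≤ xc u × xc u < b) → yc u ≡ d → Step p V u v)
  × (∀ ws w z → W ≡ ws ++ (w ∷ z ∷ []) → xc z ≡ b → (c ≤ yc z × yc z < d) → Step p H w z)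
  × (∀ u v rest → W ≡ u ∷ v ∷ rest → Step p H u v → xc v - xc u ≤ + p - 1ℤ)
  × (∀ ws w z → W ≡ ws ++ (w ∷ z ∷ []) → Step p V w z → yc w - yc z ≤ + (p ℕ.* p) - 1ℤ)

iota : Rect → List Point → Pred Point 0ℓ
iota R W q = InRect R q × Any (λ t → (xc q ≤ xc t) × (yc q ≤ yc t)) W

IsOmega : ℕ → Rect → Pred Point 0ℓ → List Point → Set
IsOmega p R I W = IsWalk p R W × (iota R W ≐ I)

WalkLe : Rect → List Point → List Point → Set
WalkLe R W₁ W₂ = iota R W₁ ⊆ iota R W₂

shiftWalk : Point → List Point → List Point
shiftWalk t = map (_⊕ t)

IsLargestExt : ℕ → Rect → Rect → Pred Point 0ℓ → Pred Point 0ℓ → Set₁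
IsLargestExt p R R' I K =
  IsIdeal p (InRect R) K × ((K ∩ InRect R') ≐ I)
  × (∀ (K' : Pred Point 0ℓ) → IsIdeal p (InRect R) K' → (K' ∩ InRect R') ≐ I → K' ⊆ K)

IsSmallestExt : ℕ → Rect → Rect → Pred Point 0ℓ → Pred Point 0ℓ → Set₁
IsSmallestExt p R R' I L =
  IsIdeal p (InRect R) L × ((L ∩ InRect R') ≐ I)
  × (∀ (L' : Pred Point 0ℓ) → IsIdeal p (InRect R) L' → (L' ∩ InRect R') ≐ I → L ⊆ L')

IsUpperExt : ℕ → Rect → Rect → List Point → List Point → Set₁
IsUpperExt p R' R Z Zb = IsWalk p R Zb × IsLargestExt p R R' (iota R' Z) (iota R Zb)

IsLowerExt : ℕ → Rect → Rect → List Point → List Point → Set₁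
IsLowerExt p R' R Z Zl = IsWalk p R Zl × IsSmallestExt p R R' (iota R' Z) (iota R Zl)

IsRestr : ℕ → Rect → Rect → List Point → List Point → Set
IsRestr p R R' W W' = IsOmega p R' (iota R W ∩ InRect R') W'

module Submission where

open import Defs
open import Level using (Level; 0ℓ)
open import Data.Nat using (ℕ; _∸_; _/_)
open import Data.Nat.Divisibility using (_∣_)
open import Data.Nat.Primality using (Prime)
open import Data.Integer using (ℤ; +_; _+_; -_; _≤_; 0ℤ)
open import Data.Product using (_×_; _,_)
open import Relation.Binary.PropositionalEquality using (_≡_)
open import Relation.Unary using (Pred; _⊆_; _∩_)
open import Function.Bundles using (_⇔_)
open import Data.List using (List)

open import Data.Integer using (_-_; _*_; nonNegative)
open import Data.Integer.Properties using (≤-refl; ≤-trans; +-mono-≤; +-monoˡ-≤; neg-mono-≤; i≤j+i; +-identityˡ; +-comm; module ≤-Reasoning)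
open import Data.Integer.Tactic.RingSolver using (solve-∀)
open import Data.Product using (proj₁; proj₂)
open import Data.Product.Function.NonDependent.Propositional using (_×-⇔_)
open import Data.Sum using (inj₁; inj₂; [_,_])
open import Data.List.Relation.Unary.Any as Any using ()
open import Data.List.Relation.Unary.Any.Properties using (map⁺; map⁻)
open import Relation.Binary.PropositionalEquality using (refl; sym; cong₂; subst)
open import Relation.Unary using (_≐_; _∪_)
open import Relation.Unary.Properties using (≐-sym; ≐-trans)
open import Function.Bundles using (mk⇔; Equivalence)
import Function.Properties.Equivalence as ⇔

-- The cone S = J + D + (a,-b) is ≺-downward closed, and since J is an ideal of U
-- it meets the translated square (a,-b) + U exactly in J + (a,-b); hence S ∩ R is the
-- smallest ideal of R = [0,a+n] × [-b,n] containing J + (a,-b), i.e. the ideal of the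
-- lower extension of W + (a,-b). For a downward closed S, S ∩ U ⊆ K holds iff
-- S ∩ R ⊆ K̄, because K̄ ∪ (S ∩ R) is again an ideal of R meeting U in K. Every other
-- condition is one of these inclusions transported along ι.

open Equivalence using (to; from)

[i+j]-j≡i : ∀ i j → i + j - j ≡ i
[i+j]-j≡i = solve-∀

[i-j]+j≡i : ∀ i j → i - j + j ≡ i
[i-j]+j≡i = solve-∀

+≤⇔≤- : ∀ i j k → i + j ≤ k ⇔ i ≤ k - j
+≤⇔≤- i j k = mk⇔ to′ from′
  where
  open ≤-Reasoning
  to′ : i + j ≤ k → i ≤ k - j
  to′ i+j≤k = begin
    i         ≡⟨ sym ([i+j]-j≡i i j) ⟩
    i + j - j ≤⟨ +-monoˡ-≤ (- j) i+j≤k ⟩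
    k - j     ∎
  from′ : i ≤ k - j → i + j ≤ k
  from′ i≤k-j = begin
    i + j     ≤⟨ +-monoˡ-≤ j i≤k-j ⟩
    k - j + j ≡⟨ [i-j]+j≡i k j ⟩
    k         ∎

≤+⇔-≤ : ∀ i j k → i ≤ k + j ⇔ i - j ≤ k
≤+⇔-≤ i j k = mk⇔ to′ from′
  where
  open ≤-Reasoning
  to′ : i ≤ k + j → i - j ≤ k
  to′ i≤k+j = begin
    i - j     ≤⟨ +-monoˡ-≤ (- j) i≤k+j ⟩
    k + j - j ≡⟨ [i+j]-j≡i k j ⟩
    k         ∎
  from′ : i - j ≤ k → i ≤ k + j
  from′ i-j≤k = begin
    i         ≡⟨ sym ([i-j]+j≡i i j) ⟩
    i - j + j ≤⟨ +-monoˡ-≤ j i-j≤k ⟩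
    k + j     ∎

⊕-⊖-cancel : ∀ u t → (u ⊕ t) ⊖ t ≡ u
⊕-⊖-cancel (x , y) (h , v) = cong₂ _,_ ([i+j]-j≡i x h) ([i+j]-j≡i y v)

⊖-⊖-self : ∀ u t → (u ⊖ (u ⊖ t)) ⊖ t ≡ (0ℤ , 0ℤ)
⊖-⊖-self (x , y) (h , v) = cong₂ _,_ (i-[i-j]-j≡0 x h) (i-[i-j]-j≡0 y v)
  where
  i-[i-j]-j≡0 : ∀ i j → i - (i - j) - j ≡ 0ℤ
  i-[i-j]-j≡0 = solve-∀

⊖-⊖-split : ∀ v u j t → (v ⊖ j) ⊖ t ≡ (v ⊖ u) ⊕ ((u ⊖ j) ⊖ t)
⊖-⊖-split (x , y) (x′ , y′) (x″ , y″) (h , v) = cong₂ _,_ (i-j-l≡[i-k]+[k-j-l] x x′ x″ h) (i-j-l≡[i-k]+[k-j-l] y y′ y″ v)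
  where
  i-j-l≡[i-k]+[k-j-l] : ∀ i k j l → i - j - l ≡ (i - k) + (k - j - l)
  i-j-l≡[i-k]+[k-j-l] = solve-∀

⊖-⊖-assoc : ∀ u j t → (u ⊖ j) ⊖ t ≡ u ⊖ (j ⊕ t)
⊖-⊖-assoc (x , y) (x′ , y′) (h , v) = cong₂ _,_ (i-j-k≡i-[j+k] x x′ h) (i-j-k≡i-[j+k] y y′ v)
  where
  i-j-k≡i-[j+k] : ∀ i j k → i - j - k ≡ i - (j + k)
  i-j-k≡i-[j+k] = solve-∀

⊖-⊖-comm : ∀ u j t → (u ⊖ j) ⊖ t ≡ (u ⊖ t) ⊖ j
⊖-⊖-comm (x , y) (x′ , y′) (h , v) = cong₂ _,_ (i-j-k≡i-k-j x x′ h) (i-j-k≡i-k-j y y′ v)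
  where
  i-j-k≡i-k-j : ∀ i j k → i - j - k ≡ i - k - j
  i-j-k≡i-k-j = solve-∀

InD-zero : ∀ p → InD p (0ℤ , 0ℤ)
InD-zero p = subst (_≤ 0ℤ) (sym (0+q*0≡0 (+ p))) ≤-refl , subst (_≤ 0ℤ) (sym (q*q*0+0≡0 (+ p))) ≤-refl
  where
  0+q*0≡0 : ∀ q → 0ℤ + q * 0ℤ ≡ 0ℤ
  0+q*0≡0 = solve-∀
  q*q*0+0≡0 : ∀ q → q * q * 0ℤ + 0ℤ ≡ 0ℤ
  q*q*0+0≡0 = solve-∀

InD-⊕ : ∀ p {d e} → InD p d → InD p e → InD p (d ⊕ e)
InD-⊕ p {x , y} {x′ , y′} (d₁ , d₂) (e₁ , e₂) =
  subst (_≤ 0ℤ) (sym (distrib₁ x x′ y y′ (+ p))) (+-mono-≤ d₁ e₁) ,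
  subst (_≤ 0ℤ) (sym (distrib₂ x x′ y y′ (+ p))) (+-mono-≤ d₂ e₂)
  where
  distrib₁ : ∀ x x′ y y′ q → (x + x′) + q * (y + y′) ≡ (x + q * y) + (x′ + q * y′)
  distrib₁ = solve-∀
  distrib₂ : ∀ x x′ y y′ q → q * q * (x + x′) + (y + y′) ≡ (q * q * x + y) + (q * q * x′ + y′)
  distrib₂ = solve-∀

InRect-translate : ∀ t R {u} → InRect (translateRect t R) u ⇔ InRect R (u ⊖ t)
InRect-translate (h , v) (rect a b c d) {x , y} =
  (+≤⇔≤- a h x ×-⇔ ≤+⇔-≤ x h b) ×-⇔ (+≤⇔≤- c v y ×-⇔ ≤+⇔-≤ y v d)

InRect-mono : ∀ {a b c d a′ b′ c′ d′} → a′ ≤ a → b ≤ b′ → c′ ≤ c → d ≤ d′ →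
              InRect (rect a b c d) ⊆ InRect (rect a′ b′ c′ d′)
InRect-mono a′≤a b≤b′ c′≤c d≤d′ ((a≤x , x≤b) , (c≤y , y≤d)) =
  (≤-trans a′≤a a≤x , ≤-trans x≤b b≤b′) , (≤-trans c′≤c c≤y , ≤-trans y≤d d≤d′)

iota-shiftWalk : ∀ t R W → iota (translateRect t R) (shiftWalk t W) ≐ ShiftSet (iota R W) t
iota-shiftWalk t@(h , v) R W =
  (λ (q∈R , below) → to (InRect-translate t R) q∈R , Any.map (to below⇔) (map⁻ below)) ,
  (λ (q∈R , below) → from (InRect-translate t R) q∈R , map⁺ (Any.map (from below⇔) below))
  where
  below⇔ : ∀ {q w} → (xc q ≤ xc (w ⊕ t) × yc q ≤ yc (w ⊕ t)) ⇔ (xc (q ⊖ t) ≤ xc w × yc (q ⊖ t) ≤ yc w)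
  below⇔ {x , y} {x′ , y′} = ≤+⇔-≤ x h x′ ×-⇔ ≤+⇔-≤ y v y′

shiftSet-resp-≐ : ∀ {X Y : Pred Point 0ℓ} t → X ≐ Y → ShiftSet X t ≐ ShiftSet Y t
shiftSet-resp-≐ t (X⊆Y , Y⊆X) = (λ {u} → X⊆Y {u ⊖ t}) , (λ {u} → Y⊆X {u ⊖ t})

private
  variable
    a ℓ : Level
    A : Set a

⊆-resp-≐ : {P P′ Q Q′ : Pred A ℓ} → P ≐ P′ → Q ≐ Q′ → (P ⊆ Q) ⇔ (P′ ⊆ Q′)
⊆-resp-≐ {P = P} {P′} {Q} {Q′} (P⊆P′ , P′⊆P) (Q⊆Q′ , Q′⊆Q) = mk⇔ to′ from′
  where
  to′ : P ⊆ Q → P′ ⊆ Q′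
  to′ P⊆Q x∈P′ = Q⊆Q′ (P⊆Q (P′⊆P x∈P′))
  from′ : P′ ⊆ Q′ → P ⊆ Q
  from′ P′⊆Q′ x∈P = Q′⊆Q (P′⊆Q′ (P⊆P′ x∈P))

∩-congˡ-≐ : {P P′ Q : Pred A ℓ} → P ≐ P′ → (P ∩ Q) ≐ (P′ ∩ Q)
∩-congˡ-≐ (P⊆P′ , P′⊆P) = (λ (x∈P , x∈Q) → P⊆P′ x∈P , x∈Q) , (λ (x∈P′ , x∈Q) → P′⊆P x∈P′ , x∈Q)

∩-∩-absorb : {P Q C : Pred A ℓ} → C ⊆ Q → ((P ∩ Q) ∩ C) ≐ (P ∩ C)
∩-∩-absorb C⊆Q = (λ ((x∈P , _) , x∈C) → x∈P , x∈C) , (λ (x∈P , x∈C) → (x∈P , C⊆Q x∈C) , x∈C)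

⊆∩⇔⊆ : {P Q C : Pred A ℓ} → P ⊆ C → (P ⊆ Q ∩ C) ⇔ (P ⊆ Q)
⊆∩⇔⊆ {P = P} {Q} {C} P⊆C = mk⇔ to′ from′
  where
  to′ : P ⊆ Q ∩ C → P ⊆ Q
  to′ P⊆Q∩C x∈P = proj₁ (P⊆Q∩C x∈P)
  from′ : P ⊆ Q → P ⊆ Q ∩ C
  from′ P⊆Q x∈P = P⊆Q x∈P , P⊆C x∈P

DownwardClosed : ℕ → Pred Point 0ℓ → Set
DownwardClosed p S = ∀ u v → S u → Prec p v u → S v

module Ideals (p : ℕ) where

  downwardClosed⇒∩-isIdeal : ∀ {S Ω} → DownwardClosed p S → IsIdeal p Ω (S ∩ Ω)
  downwardClosed⇒∩-isIdeal S↓ = proj₂ , λ u v (u∈S , _) v∈Ω v≺u → S↓ u v u∈S v≺u , v∈Ω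

  ∪-isIdeal : ∀ {Ω I I′} → IsIdeal p Ω I → IsIdeal p Ω I′ → IsIdeal p Ω (I ∪ I′)
  ∪-isIdeal (I⊆Ω , I↓) (I′⊆Ω , I′↓) =
    [ I⊆Ω , I′⊆Ω ] ,
    λ { u v (inj₁ u∈I) v∈Ω v≺u → inj₁ (I↓ u v u∈I v∈Ω v≺u)
      ; u v (inj₂ u∈I′) v∈Ω v≺u → inj₂ (I′↓ u v u∈I′ v∈Ω v≺u) }

  largestExt-unique : ∀ {R R′ I I′ K K′} → I ≐ I′ →
                      IsLargestExt p R R′ I K → IsLargestExt p R R′ I′ K′ → K ≐ K′
  largestExt-unique I≐I′ (K-ideal , K∩R′≐I , K-max) (K′-ideal , K′∩R′≐I′ , K′-max) =
    K′-max _ K-ideal (≐-trans K∩R′≐I I≐I′) , K-max _ K′-ideal (≐-trans K′∩R′≐I′ (≐-sym I≐I′))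

  smallestExt-resp-≐ : ∀ {R R′ I I′ L} → I ≐ I′ → IsSmallestExt p R R′ I L → IsSmallestExt p R R′ I′ L
  smallestExt-resp-≐ I≐I′ (L-ideal , L∩R′≐I , L-min) =
    L-ideal , ≐-trans L∩R′≐I I≐I′ , λ L′ L′-ideal L′∩R′≐I′ → L-min L′ L′-ideal (≐-trans L′∩R′≐I′ (≐-sym I≐I′))

  smallestExt-≐ : ∀ {R R′ I L M} → IsSmallestExt p R R′ I L →
                  IsIdeal p (InRect R) M → (M ∩ InRect R′) ≐ I →
                  (∀ N → IsIdeal p (InRect R) N → I ⊆ N → M ⊆ N) → L ≐ M
  smallestExt-≐ (L-ideal , (_ , I⊆L∩R′) , L-min) M-ideal M∩R′≐I M-least =
    L-min _ M-ideal M∩R′≐I , M-least _ L-ideal (λ x∈I → proj₁ (I⊆L∩R′ x∈I))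

  largestExt-⊆⇔ : ∀ {R R′ I K S} → InRect R′ ⊆ InRect R → IsLargestExt p R R′ I K → DownwardClosed p S →
                  (S ∩ InRect R′ ⊆ I) ⇔ (S ∩ InRect R ⊆ K)
  largestExt-⊆⇔ {R} {R′} {I} {K} {S} R′⊆R (K-ideal , (K∩R′⊆I , I⊆K∩R′) , K-max) S↓ = mk⇔ to′ from′
    where
    K∪S∩R : Pred Point 0ℓ
    K∪S∩R = K ∪ (S ∩ InRect R)
    to′ : S ∩ InRect R′ ⊆ I → S ∩ InRect R ⊆ K
    to′ S∩R′⊆I x∈S∩R = K-max K∪S∩R (∪-isIdeal K-ideal (downwardClosed⇒∩-isIdeal S↓)) (⊆I , ⊇I) (inj₂ x∈S∩R)
      where
      ⊆I : K∪S∩R ∩ InRect R′ ⊆ I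
      ⊆I (inj₁ x∈K , x∈R′) = K∩R′⊆I (x∈K , x∈R′)
      ⊆I (inj₂ (x∈S , _) , x∈R′) = S∩R′⊆I (x∈S , x∈R′)
      ⊇I : I ⊆ K∪S∩R ∩ InRect R′
      ⊇I x∈I = inj₁ (proj₁ (I⊆K∩R′ x∈I)) , proj₂ (I⊆K∩R′ x∈I)
    from′ : S ∩ InRect R ⊆ K → S ∩ InRect R′ ⊆ I
    from′ S∩R⊆K (x∈S , x∈R′) = K∩R′⊆I (S∩R⊆K (x∈S , R′⊆R x∈R′) , x∈R′)

  shiftSet⊆shiftCone : ∀ {X t} → ShiftSet X t ⊆ ShiftCone p X t
  shiftSet⊆shiftCone {t = t} {u} u-t∈X = u ⊖ t , u-t∈X , subst (InD p) (sym (⊖-⊖-self u t)) (InD-zero p)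

  shiftCone-downwardClosed : ∀ {X t} → DownwardClosed p (ShiftCone p X t)
  shiftCone-downwardClosed {t = t} u v (j , j∈X , u-j-t∈D) v≺u =
    j , j∈X , subst (InD p) (sym (⊖-⊖-split v u j t)) (InD-⊕ p v≺u u-j-t∈D)

  shiftCone∩⊆ideal : ∀ {X t Ω I} → IsIdeal p Ω I → ShiftSet X t ⊆ I → ShiftCone p X t ∩ Ω ⊆ I
  shiftCone∩⊆ideal {X} {t} (_ , I↓) X+t⊆I {u} ((j , j∈X , u-j-t∈D) , u∈Ω) =
    I↓ (j ⊕ t) u (X+t⊆I (subst X (sym (⊕-⊖-cancel j t)) j∈X)) u∈Ω (subst (InD p) (⊖-⊖-assoc u j t) u-j-t∈D)

  shiftSet⊆⇔shiftCone∩⊆ : ∀ {X t Ω I} → IsIdeal p Ω I → ShiftSet X t ⊆ Ω →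
                          (ShiftSet X t ⊆ I) ⇔ (ShiftCone p X t ∩ Ω ⊆ I)
  shiftSet⊆⇔shiftCone∩⊆ {X} {t} {Ω} {I} I-ideal X+t⊆Ω = mk⇔ (shiftCone∩⊆ideal I-ideal) from′
    where
    from′ : ShiftCone p X t ∩ Ω ⊆ I → ShiftSet X t ⊆ I
    from′ S∩Ω⊆I {u} u∈X+t = S∩Ω⊆I (shiftSet⊆shiftCone {X} {t} {u} u∈X+t , X+t⊆Ω {u} u∈X+t)

  shiftSet⊆translate : ∀ {R X t} → IsIdeal p (InRect R) X → ShiftSet X t ⊆ InRect (translateRect t R)
  shiftSet⊆translate {R} {t = t} (X⊆R , _) u-t∈X = from (InRect-translate t R) (X⊆R u-t∈X)

  shiftCone∩translate⊆shiftSet : ∀ {R X t} → IsIdeal p (InRect R) X →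
                                 ShiftCone p X t ∩ InRect (translateRect t R) ⊆ ShiftSet X t
  shiftCone∩translate⊆shiftSet {R} {t = t} (_ , X↓) {u} ((j , j∈X , u-j-t∈D) , u∈R+t) =
    X↓ j (u ⊖ t) j∈X (to (InRect-translate t R) u∈R+t) (subst (InD p) (⊖-⊖-comm u j t) u-j-t∈D)

  smallestExt≐shiftCone∩ : ∀ {R R′ X t L} → IsIdeal p (InRect R′) X → InRect (translateRect t R′) ⊆ InRect R →
                           IsSmallestExt p R (translateRect t R′) (ShiftSet X t) L →
                           L ≐ (ShiftCone p X t ∩ InRect R)
  smallestExt≐shiftCone∩ {R} {R′} {X} {t} X-ideal R′+t⊆R L-ext =
    smallestExt-≐ L-ext (downwardClosed⇒∩-isIdeal shiftCone-downwardClosed) (⊆X+t , ⊇X+t)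
                  (λ _ N-ideal X+t⊆N → shiftCone∩⊆ideal N-ideal X+t⊆N)
    where
    ⊆X+t : (ShiftCone p X t ∩ InRect R) ∩ InRect (translateRect t R′) ⊆ ShiftSet X t
    ⊆X+t ((u∈S , _) , u∈R′+t) = shiftCone∩translate⊆shiftSet {R′} {X} {t} X-ideal (u∈S , u∈R′+t)
    ⊇X+t : ShiftSet X t ⊆ (ShiftCone p X t ∩ InRect R) ∩ InRect (translateRect t R′)
    ⊇X+t {u} u∈X+t = (shiftSet⊆shiftCone {X} {t} {u} u∈X+t , R′+t⊆R u∈R′+t) , u∈R′+t
      where u∈R′+t = shiftSet⊆translate {R′} {X} {t} X-ideal {u} u∈X+t

shiftCone∩⊆-equivalences :
  ∀ p (U R U′ : Rect) (t : Point) →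
  InRect U ⊆ InRect R → translateRect t U ≡ U′ → InRect U′ ⊆ InRect R →
  (J K : Pred Point 0ℓ) → IsIdeal p (InRect U) J →
  (W Z : List Point) → iota U W ≐ J → iota U Z ≐ K →
  (Kbar : Pred Point 0ℓ) → IsLargestExt p R U K Kbar →
  (Wl Zb Wlr Zbr : List Point) →
  IsSmallestExt p R U′ (iota U′ (shiftWalk t W)) (iota R Wl) →
  IsLargestExt p R U (iota U Z) (iota R Zb) →
  iota U Wlr ≐ (iota R Wl ∩ InRect U) →
  iota U′ Zbr ≐ (iota R Zb ∩ InRect U′) →
  let P1 = (ShiftCone p J t ∩ InRect U) ⊆ K
      P2 = ShiftSet J t ⊆ (Kbar ∩ InRect U′)
      P3 = (ShiftCone p J t ∩ InRect R) ⊆ Kbar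
      P4 = WalkLe U Wlr Z
      P5 = WalkLe U′ (shiftWalk t W) Zbr
      P6 = WalkLe R Wl Zb
  in (P1 ⇔ P2) × (P1 ⇔ P3) × (P1 ⇔ P4) × (P1 ⇔ P5) × (P1 ⇔ P6)
shiftCone∩⊆-equivalences p U R _ t U⊆R refl U′⊆R J K J-ideal W Z W≐J Z≐K Kbar Kbar-ext
  Wl Zb Wlr Zbr Wl-ext Zb-ext Wlr≐Wl∩U Zbr≐Zb∩U′ =
  P1⇔P2 , P1⇔P3 , ⊆-resp-≐ (≐-sym Wlr≐S∩U) (≐-sym Z≐K) ,
  ⇔.trans P1⇔P2 (⊆-resp-≐ (≐-sym W+t≐T) (≐-sym Zbr≐Kbar∩U′)) ,
  ⇔.trans P1⇔P3 (⊆-resp-≐ (≐-sym Wl≐S∩R) Kbar≐Zb)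
  where
  open Ideals p
  S T : Pred Point 0ℓ
  S = ShiftCone p J t
  T = ShiftSet J t
  T⊆U′ : T ⊆ InRect (translateRect t U)
  T⊆U′ {u} = shiftSet⊆translate {R = U} {X = J} {t = t} J-ideal {u}
  W+t≐T : iota (translateRect t U) (shiftWalk t W) ≐ T
  W+t≐T = ≐-trans (iota-shiftWalk t U W) (shiftSet-resp-≐ t W≐J)
  Kbar≐Zb : Kbar ≐ iota R Zb
  Kbar≐Zb = largestExt-unique (≐-sym Z≐K) Kbar-ext Zb-ext
  Wl≐S∩R : iota R Wl ≐ (S ∩ InRect R)
  Wl≐S∩R = smallestExt≐shiftCone∩ J-ideal U′⊆R (smallestExt-resp-≐ W+t≐T Wl-ext)
  Wlr≐S∩U : iota U Wlr ≐ (S ∩ InRect U)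
  Wlr≐S∩U = ≐-trans Wlr≐Wl∩U (≐-trans (∩-congˡ-≐ Wl≐S∩R) (∩-∩-absorb U⊆R))
  Zbr≐Kbar∩U′ : iota (translateRect t U) Zbr ≐ (Kbar ∩ InRect (translateRect t U))
  Zbr≐Kbar∩U′ = ≐-trans Zbr≐Zb∩U′ (∩-congˡ-≐ (≐-sym Kbar≐Zb))
  P1⇔P3 : (S ∩ InRect U ⊆ K) ⇔ (S ∩ InRect R ⊆ Kbar)
  P1⇔P3 = largestExt-⊆⇔ U⊆R Kbar-ext shiftCone-downwardClosed
  P1⇔P2 : (S ∩ InRect U ⊆ K) ⇔ (T ⊆ Kbar ∩ InRect (translateRect t U))
  P1⇔P2 = ⇔.trans P1⇔P3 (⇔.sym (⇔.trans (⊆∩⇔⊆ T⊆U′) (shiftSet⊆⇔shiftCone∩⊆ (proj₁ Kbar-ext) T⊆R)))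
    where
    T⊆R : T ⊆ InRect R
    T⊆R {u} u∈T = U′⊆R (T⊆U′ {u} u∈T)

translate-square : ∀ n h v → translateRect (h , v) (rect 0ℤ n 0ℤ n) ≡ rect h (h + n) v (v + n)
translate-square n h v rewrite +-identityˡ h | +-identityˡ v | +-comm n h | +-comm n v = refl

lemma4p2 : (p m : ℕ) → Prime p → 0 Data.Nat.< m → 3 ∣ m →
  (n : ℤ) → n ≡ + ((m / 3) Data.Nat.* (p ∸ 1)) →
  (J K : Pred Point 0ℓ) →
  IsIdeal p (InRect (rect 0ℤ n 0ℤ n)) J → IsIdeal p (InRect (rect 0ℤ n 0ℤ n)) K →
  (W Z : List Point) →
  IsOmega p (rect 0ℤ n 0ℤ n) J W → IsOmega p (rect 0ℤ n 0ℤ n) K Z →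
  (a b : ℤ) → 0ℤ ≤ a → 0ℤ ≤ b →
  (Kbar : Pred Point 0ℓ) →
  IsLargestExt p (rect 0ℤ (a + n) (- b) n) (rect 0ℤ n 0ℤ n) K Kbar →
  (Wl Zb Wlr Zbr : List Point) →
  IsLowerExt p (rect a (a + n) (- b) (- b + n)) (rect 0ℤ (a + n) (- b) n) (shiftWalk (a , - b) W) Wl →
  IsUpperExt p (rect 0ℤ n 0ℤ n) (rect 0ℤ (a + n) (- b) n) Z Zb →
  IsRestr p (rect 0ℤ (a + n) (- b) n) (rect 0ℤ n 0ℤ n) Wl Wlr →
  IsRestr p (rect 0ℤ (a + n) (- b) n) (rect a (a + n) (- b) (- b + n)) Zb Zbr →
  let P1 = (ShiftCone p J (a , - b) ∩ InRect (rect 0ℤ n 0ℤ n)) ⊆ K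
      P2 = ShiftSet J (a , - b) ⊆ (Kbar ∩ InRect (rect a (a + n) (- b) (- b + n)))
      P3 = (ShiftCone p J (a , - b) ∩ InRect (rect 0ℤ (a + n) (- b) n)) ⊆ Kbar
      P4 = WalkLe (rect 0ℤ n 0ℤ n) Wlr Z
      P5 = WalkLe (rect a (a + n) (- b) (- b + n)) (shiftWalk (a , - b) W) Zbr
      P6 = WalkLe (rect 0ℤ (a + n) (- b) n) Wl Zb
  in (P1 ⇔ P2) × (P1 ⇔ P3) × (P1 ⇔ P4) × (P1 ⇔ P5) × (P1 ⇔ P6)
lemma4p2 p m _ _ _ n _ J K J-ideal _ W Z (_ , W≐J) (_ , Z≐K) a b 0≤a 0≤b Kbar Kbar-ext
  Wl Zb Wlr Zbr (_ , Wl-ext) (_ , Zb-ext) (_ , Wlr≐Wl∩U) (_ , Zbr≐Zb∩U′) =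
  shiftCone∩⊆-equivalences p _ _ _ (a , - b) U⊆R (translate-square n a (- b)) U′⊆R
    J K J-ideal W Z W≐J Z≐K Kbar Kbar-ext Wl Zb Wlr Zbr Wl-ext Zb-ext Wlr≐Wl∩U Zbr≐Zb∩U′
  where
  open ≤-Reasoning
  -b≤0 : - b ≤ 0ℤ
  -b≤0 = neg-mono-≤ 0≤b
  n≤a+n : n ≤ a + n
  n≤a+n = i≤j+i n a {{nonNegative 0≤a}}
  -b+n≤n : - b + n ≤ n
  -b+n≤n = begin
    - b + n ≤⟨ +-monoˡ-≤ n -b≤0 ⟩
    0ℤ + n  ≡⟨ +-identityˡ n ⟩
    n       ∎
  U⊆R : InRect (rect 0ℤ n 0ℤ n) ⊆ InRect (rect 0ℤ (a + n) (- b) n)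
  U⊆R = InRect-mono ≤-refl n≤a+n -b≤0 ≤-refl
  U′⊆R : InRect (rect a (a + n) (- b) (- b + n)) ⊆ InRect (rect 0ℤ (a + n) (- b) n)
  U′⊆R = InRect-mono 0≤a ≤-refl ≤-refl -b+n≤n
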